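{- Let $n\ge 1$ and let $R$ be the $n\times n$ reciprocal Pascal matrix, $R_{i,j}=1/\binom{i+j}{i}$ for $0\le i,j<n$. Then $R$ is invertible and every entry of $R^{ -1}$ is an integer.
   Context: Matrices are indexed starting at $0$. -}

module Defs where

open import Data.Nat as ℕ using (ℕ; zero; suc; _≤_; _<_; z≤n; s≤s; NonZero)
open import Data.Nat.Properties using (≤-trans; m≤m+n)
open import Data.Nat.Base using (>-nonZero)
open import Data.Nat.Combinatorics using (_C_; nCk+nC[k+1]≡[n+1]C[k+1])
open import Data.Integer using (ℤ; +_)
open import Data.Rational using (ℚ; 0ℚ; 1ℚ; _+_; _*_; _/_)
open import Data.Fin using (Fin; toℕ) renaming (zero to fzero; suc to fsuc)
open import Relation.Binary.PropositionalEquality using (subst)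

C-pos : ∀ m k → k ≤ m → 0 < m C k
C-pos zero    zero    _         = s≤s z≤n
C-pos (suc m) zero    _         = s≤s z≤n
C-pos (suc m) (suc k) (s≤s k≤m) =
  subst (0 <_) (nCk+nC[k+1]≡[n+1]C[k+1] m k)
        (≤-trans (C-pos m k k≤m) (m≤m+n (m C k) (m C suc k)))

Matrix : Set → ℕ → Set
Matrix A n = Fin n → Fin n → A

Σℚ : (n : ℕ) → (Fin n → ℚ) → ℚ
Σℚ zero    f = 0ℚ
Σℚ (suc n) f = f fzero + Σℚ n (λ i → f (fsuc i))

_·_ : ∀ {n} → Matrix ℚ n → Matrix ℚ n → Matrix ℚ n
_·_ {n} A B i j = Σℚ n (λ k → A i k * B k j)

I : ∀ {n} → Matrix ℚ n
I fzero    fzero    = 1ℚ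
I fzero    (fsuc _) = 0ℚ
I (fsuc _) fzero    = 0ℚ
I (fsuc i) (fsuc j) = I i j

toℚ : ∀ {n} → Matrix ℤ n → Matrix ℚ n
toℚ S i j = (S i j) / 1

recipBinom : ℕ → ℕ → ℚ
recipBinom i j = ((+ 1) / ((i ℕ.+ j) C i))
  {{>-nonZero (C-pos (i ℕ.+ j) i (m≤m+n i j))}}

R : (n : ℕ) → Matrix ℚ n
R n i j = recipBinom (toℕ i) (toℕ j)

module Submission where

-- Let W be the integer matrix w k l = (-1)^l C(k,l) C(k+l-1,l), lower triangular with
-- W k k ≠ 0.  By the Chu–Vandermonde identity for falling factorials x ↓ r, row a of R Wᵀ
-- is (R Wᵀ) a k = a! (a ↓ k) / (a+k)!, which vanishes for a < k.  Hence W R Wᵀ is lower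
-- triangular; being symmetric, it is diagonal, and its diagonal entries are the 1/ε k of ε
-- below.  With E = diag ε the integer matrix S = Wᵀ E W then satisfies
-- W (R S) = (W R Wᵀ E) W = W, and cancelling the triangular W gives R S = I.  Transposing,
-- S R = I because R and S are symmetric.

open import Defs
open import Data.Nat using (ℕ; _≤_)
open import Data.Integer using (ℤ)
open import Data.Product using (∃-syntax; _×_; _,_)
open import Relation.Binary.PropositionalEquality using (_≡_)

open import Algebra.Bundles using (CommutativeRing)
import Algebra.Properties.CommutativeSemigroup as CommSemigroupProperties
open import Data.Fin as Fin using (Fin; toℕ; punchIn) renaming (zero to fzero; suc to fsuc)
open import Data.Fin.Induction using (<-wellFounded)
open import Data.Fin.Properties using (punchInᵢ≢i; toℕ≤pred[n]; toℕ<n; <-cmp; _≤?_; _≟_)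
open import Data.Integer as ℤ using (-1ℤ; _^_)
import Data.Integer.Properties as ℤP
open import Data.Nat as ℕ using (zero; suc; NonZero; _<_; _∸_; _!)
import Data.Nat.Properties as ℕP
open import Data.Nat.Combinatorics
  using (_C_; nCk+nC[k+1]≡[n+1]C[k+1]; k>n⇒nCk≡0; nCn≡1; nCk≡nC[n∸k])
open import Data.Rational as ℚ using (ℚ; 0ℚ; 1ℚ; _+_; _*_; _-_; -_; _/_)
import Data.Rational.Properties as ℚP
import Data.Rational.Unnormalised as ℚᵘ
import Data.Rational.Unnormalised.Properties as ℚᵘP
open import Data.Rational.Solver using (module +-*-Solver)
open import Data.Vec.Functional using (removeAt)
open import Induction.WellFounded using (Acc; acc)
open import Relation.Binary.Definitions using (tri<; tri≈; tri>)
open import Relation.Nullary using (yes; no)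
open import Relation.Nullary.Negation using (contradiction)
open import Relation.Binary.PropositionalEquality
  using (refl; sym; trans; cong; cong₂; subst; _≢_; module ≡-Reasoning)

open import Algebra.Properties.Semiring.Sum (CommutativeRing.semiring ℚP.+-*-commutativeRing)
  using (sum; sum-syntax; sum-cong-≗; sum-replicate-zero; sum-remove; ∑-distrib-+; ∑-comm;
         *-distribˡ-sum; *-distribʳ-sum)
open import Algebra.Properties.Group ℚP.+-0-group using (∙-cancelʳ)
import Algebra.Properties.Semiring.Sum ℤP.+-*-semiring as ℤΣ

open +-*-Solver
open ≡-Reasoning

∑-zero : ∀ {n} (f : Fin n → ℚ) → (∀ i → f i ≡ 0ℚ) → sum f ≡ 0ℚ
∑-zero {n} f f≡0 = trans (sum-cong-≗ f≡0) (sum-replicate-zero n)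

∑-single : ∀ {n} (f : Fin n → ℚ) k → (∀ i → i ≢ k → f i ≡ 0ℚ) → sum f ≡ f k
∑-single {suc n} f k f≡0 = begin
  sum f                     ≡⟨ sum-remove {i = k} f ⟩
  f k + sum (removeAt f k)  ≡⟨ cong (f k +_) (∑-zero _ (λ i → f≡0 (punchIn k i) (punchInᵢ≢i k i))) ⟩
  f k + 0ℚ                  ≡⟨ ℚP.+-identityʳ (f k) ⟩
  f k                       ∎

∑-truncate : ∀ m d (g : ℕ → ℚ) → (∀ i → m ≤ i → g i ≡ 0ℚ) →
             ∑[ i < m ℕ.+ d ] g (toℕ i) ≡ ∑[ i < m ] g (toℕ i)
∑-truncate zero    d g g≡0 = ∑-zero {d} (λ i → g (toℕ i)) (λ i → g≡0 (toℕ i) ℕ.z≤n)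
∑-truncate (suc m) d g g≡0 =
  cong (g 0 +_) (∑-truncate m d (λ i → g (suc i)) (λ i m≤i → g≡0 (suc i) (ℕ.s≤s m≤i)))

-- Matrices over ℚ

infix 4 _≋_

_≋_ : ∀ {n} → Matrix ℚ n → Matrix ℚ n → Set
A ≋ B = ∀ i j → A i j ≡ B i j

infix 25 _ᵀ

_ᵀ : ∀ {A n} → Matrix A n → Matrix A n
(M ᵀ) i j = M j i

Σℚ≡sum : ∀ {n} (g : Fin n → ℚ) → Σℚ n g ≡ sum g
Σℚ≡sum {zero}  g = refl
Σℚ≡sum {suc n} g = cong (g fzero +_) (Σℚ≡sum (λ k → g (fsuc k)))

·-sum : ∀ {n} (A B : Matrix ℚ n) i j → (A · B) i j ≡ ∑[ k < n ] (A i k * B k j)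
·-sum A B i j = Σℚ≡sum (λ k → A i k * B k j)

·-cong : ∀ {n} {A A′ B B′ : Matrix ℚ n} → A ≋ A′ → B ≋ B′ → A · B ≋ A′ · B′
·-cong {n} {A} {A′} {B} {B′} A≋A′ B≋B′ i j = begin
  (A · B) i j                   ≡⟨ ·-sum A B i j ⟩
  ∑[ k < n ] (A i k * B k j)    ≡⟨ sum-cong-≗ (λ k → cong₂ _*_ (A≋A′ i k) (B≋B′ k j)) ⟩
  ∑[ k < n ] (A′ i k * B′ k j)  ≡⟨ sym (·-sum A′ B′ i j) ⟩
  (A′ · B′) i j                 ∎

·-congˡ : ∀ {n} (A : Matrix ℚ n) {B B′ : Matrix ℚ n} → B ≋ B′ → A · B ≋ A · B′
·-congˡ A B≋B′ = ·-cong {A = A} {A} (λ _ _ → refl) B≋B′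

·-congʳ : ∀ {n} (B : Matrix ℚ n) {A A′ : Matrix ℚ n} → A ≋ A′ → A · B ≋ A′ · B
·-congʳ B A≋A′ = ·-cong {B = B} {B} A≋A′ (λ _ _ → refl)

·-assoc : ∀ {n} (X Y Z : Matrix ℚ n) → X · (Y · Z) ≋ (X · Y) · Z
·-assoc {n} X Y Z i j = begin
  (X · (Y · Z)) i j
    ≡⟨ ·-sum X (Y · Z) i j ⟩
  ∑[ k < n ] (X i k * (Y · Z) k j)
    ≡⟨ sum-cong-≗ (λ k → trans (cong (X i k *_) (·-sum Y Z k j))
                               (*-distribˡ-sum (X i k) (λ l → Y k l * Z l j))) ⟩
  ∑[ k < n ] ∑[ l < n ] (X i k * (Y k l * Z l j))
    ≡⟨ ∑-comm (λ k l → X i k * (Y k l * Z l j)) ⟩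
  ∑[ l < n ] ∑[ k < n ] (X i k * (Y k l * Z l j))
    ≡⟨ sum-cong-≗ (λ l → trans (sum-cong-≗ (λ k → sym (ℚP.*-assoc (X i k) (Y k l) (Z l j))))
                               (sym (*-distribʳ-sum (Z l j) (λ k → X i k * Y k l)))) ⟩
  ∑[ l < n ] (∑[ k < n ] (X i k * Y k l) * Z l j)
    ≡⟨ sum-cong-≗ (λ l → cong (_* Z l j) (sym (·-sum X Y i l))) ⟩
  ∑[ l < n ] ((X · Y) i l * Z l j)
    ≡⟨ sym (·-sum (X · Y) Z i j) ⟩
  ((X · Y) · Z) i j ∎

·-ᵀ : ∀ {n} (A B : Matrix ℚ n) → (A · B) ᵀ ≋ B ᵀ · A ᵀ
·-ᵀ {n} A B i j = begin
  (A · B) j i                 ≡⟨ ·-sum A B j i ⟩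
  ∑[ k < n ] (A j k * B k i)  ≡⟨ sum-cong-≗ (λ k → ℚP.*-comm (A j k) (B k i)) ⟩
  ∑[ k < n ] (B k i * A j k)  ≡⟨ sym (·-sum (B ᵀ) (A ᵀ) i j) ⟩
  (B ᵀ · A ᵀ) i j             ∎

congruence-symmetric : ∀ {n} (A B : Matrix ℚ n) → A ᵀ ≋ A → (B · (A · B ᵀ)) ᵀ ≋ B · (A · B ᵀ)
congruence-symmetric A B Aᵀ≋A i j = begin
  (B · (A · B ᵀ)) j i      ≡⟨ ·-ᵀ B (A · B ᵀ) i j ⟩
  ((A · B ᵀ) ᵀ · B ᵀ) i j  ≡⟨ ·-congʳ (B ᵀ) (·-ᵀ A (B ᵀ)) i j ⟩
  ((B · A ᵀ) · B ᵀ) i j    ≡⟨ ·-congʳ (B ᵀ) (·-congˡ B Aᵀ≋A) i j ⟩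
  ((B · A) · B ᵀ) i j      ≡⟨ sym (·-assoc B A (B ᵀ) i j) ⟩
  (B · (A · B ᵀ)) i j      ∎

I-diagonal : ∀ {n} (i : Fin n) → I i i ≡ 1ℚ
I-diagonal fzero    = refl
I-diagonal (fsuc i) = I-diagonal i

I-offDiagonal : ∀ {n} {i j : Fin n} → i ≢ j → I i j ≡ 0ℚ
I-offDiagonal {i = fzero}  {fzero}  i≢j = contradiction refl i≢j
I-offDiagonal {i = fzero}  {fsuc j} i≢j = refl
I-offDiagonal {i = fsuc i} {fzero}  i≢j = refl
I-offDiagonal {i = fsuc i} {fsuc j} i≢j = I-offDiagonal (λ i≡j → i≢j (cong fsuc i≡j))

I-symmetric : ∀ {n} → I ᵀ ≋ I {n}
I-symmetric fzero    fzero    = refl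
I-symmetric fzero    (fsuc j) = refl
I-symmetric (fsuc i) fzero    = refl
I-symmetric (fsuc i) (fsuc j) = I-symmetric i j

diag : ∀ {n} → (Fin n → ℚ) → Matrix ℚ n
diag d i j = d i * I i j

·-diag : ∀ {n} (A : Matrix ℚ n) d i j → (A · diag d) i j ≡ A i j * d j
·-diag {n} A d i j = begin
  (A · diag d) i j                 ≡⟨ ·-sum A (diag d) i j ⟩
  ∑[ k < n ] (A i k * diag d k j)  ≡⟨ ∑-single (λ k → A i k * diag d k j) j off-j ⟩
  A i j * (d j * I j j)            ≡⟨ cong (λ x → A i j * (d j * x)) (I-diagonal j) ⟩
  A i j * (d j * 1ℚ)               ≡⟨ cong (A i j *_) (ℚP.*-identityʳ (d j)) ⟩
  A i j * d j                      ∎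
  where
  off-j : ∀ k → k ≢ j → A i k * diag d k j ≡ 0ℚ
  off-j k k≢j = begin
    A i k * (d k * I k j)  ≡⟨ cong (λ x → A i k * (d k * x)) (I-offDiagonal k≢j) ⟩
    A i k * (d k * 0ℚ)     ≡⟨ cong (A i k *_) (ℚP.*-zeroʳ (d k)) ⟩
    A i k * 0ℚ             ≡⟨ ℚP.*-zeroʳ (A i k) ⟩
    0ℚ                     ∎

diag-· : ∀ {n} d (A : Matrix ℚ n) i j → (diag d · A) i j ≡ d i * A i j
diag-· {n} d A i j = begin
  (diag d · A) i j                 ≡⟨ ·-sum (diag d) A i j ⟩
  ∑[ k < n ] (diag d i k * A k j)  ≡⟨ ∑-single (λ k → diag d i k * A k j) i off-i ⟩
  d i * I i i * A i j              ≡⟨ cong (λ x → d i * x * A i j) (I-diagonal i) ⟩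
  d i * 1ℚ * A i j                 ≡⟨ cong (_* A i j) (ℚP.*-identityʳ (d i)) ⟩
  d i * A i j                      ∎
  where
  off-i : ∀ k → k ≢ i → diag d i k * A k j ≡ 0ℚ
  off-i k k≢i = begin
    d i * I i k * A k j    ≡⟨ cong (λ x → d i * x * A k j) (I-offDiagonal (λ i≡k → k≢i (sym i≡k))) ⟩
    d i * 0ℚ * A k j       ≡⟨ cong (_* A k j) (ℚP.*-zeroʳ (d i)) ⟩
    0ℚ * A k j             ≡⟨ ℚP.*-zeroˡ (A k j) ⟩
    0ℚ                     ∎

·-identityˡ : ∀ {n} (A : Matrix ℚ n) → I · A ≋ A
·-identityˡ A i j = trans (·-congʳ A {I} (λ i k → sym (ℚP.*-identityˡ (I i k))) i j)
                          (trans (diag-· (λ _ → 1ℚ) A i j) (ℚP.*-identityˡ (A i j)))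

·-identityʳ : ∀ {n} (A : Matrix ℚ n) → A · I ≋ A
·-identityʳ A i j = trans (·-congˡ A {I} (λ k j → sym (ℚP.*-identityˡ (I k j))) i j)
                          (trans (·-diag A (λ _ → 1ℚ) i j) (ℚP.*-identityʳ (A i j)))

LowerTriangular : ∀ {n} → Matrix ℚ n → Set
LowerTriangular A = ∀ {i j} → i Fin.< j → A i j ≡ 0ℚ

·-lowerTriangular : ∀ {n} {A B : Matrix ℚ n} → LowerTriangular A → LowerTriangular B →
                    LowerTriangular (A · B)
·-lowerTriangular {n} {A} {B} A-lower B-lower {i} {j} i<j = begin
  (A · B) i j                 ≡⟨ ·-sum A B i j ⟩
  ∑[ k < n ] (A i k * B k j)  ≡⟨ ∑-zero (λ k → A i k * B k j) term≡0 ⟩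
  0ℚ                          ∎
  where
  term≡0 : ∀ k → A i k * B k j ≡ 0ℚ
  term≡0 k with k ≤? i
  ... | yes k≤i = trans (cong (A i k *_) (B-lower (ℕP.≤-<-trans k≤i i<j))) (ℚP.*-zeroʳ (A i k))
  ... | no  k≰i = trans (cong (_* B k j) (A-lower (ℕP.≰⇒> k≰i))) (ℚP.*-zeroˡ (B k j))

·-lowerTriangular-diagonal : ∀ {n} {A B : Matrix ℚ n} → LowerTriangular A → LowerTriangular B →
                             ∀ i → (A · B) i i ≡ A i i * B i i
·-lowerTriangular-diagonal {n} {A} {B} A-lower B-lower i = begin
  (A · B) i i                 ≡⟨ ·-sum A B i i ⟩
  ∑[ k < n ] (A i k * B k i)  ≡⟨ ∑-single (λ k → A i k * B k i) i term≡0 ⟩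
  A i i * B i i               ∎
  where
  term≡0 : ∀ k → k ≢ i → A i k * B k i ≡ 0ℚ
  term≡0 k k≢i with <-cmp k i
  ... | tri< k<i _ _ = trans (cong (A i k *_) (B-lower k<i)) (ℚP.*-zeroʳ (A i k))
  ... | tri≈ _ k≡i _ = contradiction k≡i k≢i
  ... | tri> _ _ i<k = trans (cong (_* B k i) (A-lower i<k)) (ℚP.*-zeroˡ (B k i))

*-cancelˡ-≢0 : ∀ {a x y} → a ≢ 0ℚ → a * x ≡ a * y → x ≡ y
*-cancelˡ-≢0 {a} {x} {y} a≢0 ax≡ay = begin
  x                 ≡⟨ sym (ℚP.*-identityˡ x) ⟩
  1ℚ * x            ≡⟨ cong (_* x) (sym (ℚP.*-inverseˡ a)) ⟩
  ℚ.1/ a * a * x    ≡⟨ ℚP.*-assoc (ℚ.1/ a) a x ⟩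
  ℚ.1/ a * (a * x)  ≡⟨ cong (ℚ.1/ a *_) ax≡ay ⟩
  ℚ.1/ a * (a * y)  ≡⟨ sym (ℚP.*-assoc (ℚ.1/ a) a y) ⟩
  ℚ.1/ a * a * y    ≡⟨ cong (_* y) (ℚP.*-inverseˡ a) ⟩
  1ℚ * y            ≡⟨ ℚP.*-identityˡ y ⟩
  y                 ∎
  where
  instance
    a-nonZero : ℚ.NonZero a
    a-nonZero = ℚ.≢-nonZero a≢0

lowerTriangular-cancelˡ : ∀ {n} {A X Y : Matrix ℚ n} → LowerTriangular A → (∀ i → A i i ≢ 0ℚ) →
                          A · X ≋ A · Y → X ≋ Y
lowerTriangular-cancelˡ {zero}  _ _ _ ()
lowerTriangular-cancelˡ {suc n} {A} {X} {Y} A-lower A-regular AX≋AY i j = row i (<-wellFounded i)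
  where
  -- Forward substitution: once the rows above i agree, the i-th rows of A · X and A · Y
  -- differ only in the term A i i * X i j versus A i i * Y i j.
  row : ∀ i → Acc Fin._<_ i → X i j ≡ Y i j
  row i (acc below) = *-cancelˡ-≢0 (A-regular i) (∙-cancelʳ (sum (removeAt u i)) (t i) (u i) (begin
    t i + sum (removeAt u i)  ≡⟨ cong (t i +_) (sum-cong-≗ (λ k → sym (t≡u (punchIn i k) (punchInᵢ≢i i k)))) ⟩
    t i + sum (removeAt t i)  ≡⟨ sym (sum-remove t) ⟩
    sum t                     ≡⟨ trans (sym (·-sum A X i j)) (trans (AX≋AY i j) (·-sum A Y i j)) ⟩
    sum u                     ≡⟨ sum-remove u ⟩
    u i + sum (removeAt u i)  ∎))
    where
    t u : Fin (suc n) → ℚ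
    t k = A i k * X k j
    u k = A i k * Y k j

    t≡u : ∀ k → k ≢ i → t k ≡ u k
    t≡u k k≢i with <-cmp k i
    ... | tri< k<i _ _ = cong (A i k *_) (row k (below k<i))
    ... | tri≈ _ k≡i _ = contradiction k≡i k≢i
    ... | tri> _ _ i<k = begin
      A i k * X k j  ≡⟨ cong (_* X k j) (A-lower i<k) ⟩
      0ℚ * X k j     ≡⟨ ℚP.*-zeroˡ (X k j) ⟩
      0ℚ             ≡⟨ sym (ℚP.*-zeroˡ (Y k j)) ⟩
      0ℚ * Y k j     ≡⟨ cong (_* Y k j) (sym (A-lower i<k)) ⟩
      A i k * Y k j  ∎


ι : ℤ → ℚ
ι z = z / 1

ιᵘ : ℤ → ℚᵘ.ℚᵘ
ιᵘ z = ℚᵘ.mkℚᵘ z 0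

fromℚᵘ-homo-+ : ∀ p q → ℚ.fromℚᵘ (p ℚᵘ.+ q) ≡ ℚ.fromℚᵘ p + ℚ.fromℚᵘ q
fromℚᵘ-homo-+ p q = ℚP.toℚᵘ-injective (ℚᵘP.≃-trans (ℚP.toℚᵘ-fromℚᵘ (p ℚᵘ.+ q))
  (ℚᵘP.≃-sym (ℚᵘP.≃-trans (ℚP.toℚᵘ-homo-+ (ℚ.fromℚᵘ p) (ℚ.fromℚᵘ q))
    (ℚᵘP.+-cong (ℚP.toℚᵘ-fromℚᵘ p) (ℚP.toℚᵘ-fromℚᵘ q)))))

fromℚᵘ-homo-* : ∀ p q → ℚ.fromℚᵘ (p ℚᵘ.* q) ≡ ℚ.fromℚᵘ p * ℚ.fromℚᵘ q
fromℚᵘ-homo-* p q = ℚP.toℚᵘ-injective (ℚᵘP.≃-trans (ℚP.toℚᵘ-fromℚᵘ (p ℚᵘ.* q))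
  (ℚᵘP.≃-sym (ℚᵘP.≃-trans (ℚP.toℚᵘ-homo-* (ℚ.fromℚᵘ p) (ℚ.fromℚᵘ q))
    (ℚᵘP.*-cong (ℚP.toℚᵘ-fromℚᵘ p) (ℚP.toℚᵘ-fromℚᵘ q)))))

ι-+ : ∀ a b → ι (a ℤ.+ b) ≡ ι a + ι b
ι-+ a b = trans (ℚP.fromℚᵘ-cong {ιᵘ (a ℤ.+ b)} {ιᵘ a ℚᵘ.+ ιᵘ b} (ℚᵘ.*≡* a+b≡))
                (fromℚᵘ-homo-+ (ιᵘ a) (ιᵘ b))
  where
  a+b≡ : (a ℤ.+ b) ℤ.* ℤ.+ 1 ≡ (a ℤ.* ℤ.+ 1 ℤ.+ b ℤ.* ℤ.+ 1) ℤ.* ℤ.+ 1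
  a+b≡ = cong (ℤ._* ℤ.+ 1) (sym (cong₂ ℤ._+_ (ℤP.*-identityʳ a) (ℤP.*-identityʳ b)))

ι-* : ∀ a b → ι (a ℤ.* b) ≡ ι a * ι b
ι-* a b = trans (ℚP.fromℚᵘ-cong {ιᵘ (a ℤ.* b)} {ιᵘ a ℚᵘ.* ιᵘ b} (ℚᵘ.*≡* refl))
                (fromℚᵘ-homo-* (ιᵘ a) (ιᵘ b))

ι-∑ : ∀ {n} (f : Fin n → ℤ) → ι (ℤΣ.sum f) ≡ sum (λ i → ι (f i))
ι-∑ {zero}  f = refl
ι-∑ {suc n} f = trans (ι-+ (f fzero) _) (cong (ι (f fzero) +_) (ι-∑ (λ i → f (fsuc i))))

ι-[-1]^suc : ∀ l → ι (-1ℤ ^ suc l) ≡ - ι (-1ℤ ^ l)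
ι-[-1]^suc l = trans (ι-* -1ℤ (-1ℤ ^ l)) (solve 1 (λ x → con (ι -1ℤ) :* x := :- x) refl (ι (-1ℤ ^ l)))

ιₙ : ℕ → ℚ
ιₙ n = ι (ℤ.+ n)

ιₙ-+ : ∀ m n → ιₙ (m ℕ.+ n) ≡ ιₙ m + ιₙ n
ιₙ-+ m n = trans (cong ι (ℤP.pos-+ m n)) (ι-+ (ℤ.+ m) (ℤ.+ n))

ιₙ-* : ∀ m n → ιₙ (m ℕ.* n) ≡ ιₙ m * ιₙ n
ιₙ-* m n = trans (cong ι (ℤP.pos-* m n)) (ι-* (ℤ.+ m) (ℤ.+ n))

1/ₙ : (m : ℕ) → .{{NonZero m}} → ℚ
1/ₙ m = ℤ.+ 1 / m

1/ₙ*ιₙ : ∀ m .{{_ : NonZero m}} → 1/ₙ m * ιₙ m ≡ 1ℚ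
1/ₙ*ιₙ (suc m) = trans (sym (fromℚᵘ-homo-* (ℚᵘ.mkℚᵘ (ℤ.+ 1) m) (ιᵘ (ℤ.+ suc m))))
  (ℚP.fromℚᵘ-cong {ℚᵘ.mkℚᵘ (ℤ.+ 1) m ℚᵘ.* ιᵘ (ℤ.+ suc m)} {ιᵘ (ℤ.+ 1)}
    (ℚᵘ.*≡* (ℤP.*-assoc (ℤ.+ 1) (ℤ.+ suc m) (ℤ.+ 1))))

ιₙ-suc : ∀ n → ιₙ (suc n) ≡ 1ℚ + ιₙ n
ιₙ-suc n = ιₙ-+ 1 n

ιₙ-pred : ∀ n → ιₙ (suc n) - 1ℚ ≡ ιₙ n
ιₙ-pred n = trans (cong (_- 1ℚ) (ιₙ-suc n)) (solve 1 (λ x → con 1ℚ :+ x :- con 1ℚ := x) refl (ιₙ n))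

ιₙ-∸ : ∀ {m n} → n ≤ m → ιₙ (m ∸ n) ≡ ιₙ m - ιₙ n
ιₙ-∸ {m} {n} n≤m = begin
  ιₙ (m ∸ n)                ≡⟨ solve 2 (λ a b → a := a :+ b :- b) refl (ιₙ (m ∸ n)) (ιₙ n) ⟩
  ιₙ (m ∸ n) + ιₙ n - ιₙ n  ≡⟨ cong (_- ιₙ n) (sym (ιₙ-+ (m ∸ n) n)) ⟩
  ιₙ (m ∸ n ℕ.+ n) - ιₙ n   ≡⟨ cong (λ k → ιₙ k - ιₙ n) (ℕP.m∸n+n≡m n≤m) ⟩
  ιₙ m - ιₙ n               ∎

-- Falling factorials

infixl 8 _↓_

_↓_ : ℚ → ℕ → ℚ
x ↓ zero  = 1ℚ
x ↓ suc r = x ↓ r * (x - ιₙ r)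

↓-suc : ∀ x r → x ↓ suc r ≡ x * (x - 1ℚ) ↓ r
↓-suc x zero    = solve 1 (λ x → con 1ℚ :* (x :- con 0ℚ) := x :* con 1ℚ) refl x
↓-suc x (suc r) = begin
  x ↓ suc r * (x - ιₙ (suc r))              ≡⟨ cong₂ (λ a b → a * (x - b)) (↓-suc x r) (ιₙ-suc r) ⟩
  x * (x - 1ℚ) ↓ r * (x - (1ℚ + ιₙ r))      ≡⟨ solve 3 (λ x y n → x :* y :* (x :- (con 1ℚ :+ n))
                                                                := x :* (y :* (x :- con 1ℚ :- n)))
                                                refl x ((x - 1ℚ) ↓ r) (ιₙ r) ⟩
  x * ((x - 1ℚ) ↓ r * (x - 1ℚ - ιₙ r))      ∎

C*!≡↓ : ∀ n r → ιₙ (n C r) * ιₙ (r !) ≡ ιₙ n ↓ r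
C*!≡↓ n       zero    = refl
C*!≡↓ zero    (suc r) = trans (ℚP.*-zeroˡ (ιₙ (suc r !))) (sym (trans (↓-suc 0ℚ r) (ℚP.*-zeroˡ ((0ℚ - 1ℚ) ↓ r))))
C*!≡↓ (suc n) (suc r) = begin
  ιₙ (suc n C suc r) * ιₙ (suc r !)
    ≡⟨ cong (λ c → ιₙ c * ιₙ (suc r !)) (sym (nCk+nC[k+1]≡[n+1]C[k+1] n r)) ⟩
  ιₙ (n C r ℕ.+ n C suc r) * ιₙ (suc r !)
    ≡⟨ trans (cong (_* ιₙ (suc r !)) (ιₙ-+ (n C r) (n C suc r)))
             (ℚP.*-distribʳ-+ (ιₙ (suc r !)) (ιₙ (n C r)) (ιₙ (n C suc r))) ⟩
  ιₙ (n C r) * ιₙ (suc r !) + ιₙ (n C suc r) * ιₙ (suc r !)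
    ≡⟨ cong₂ _+_ (trans (cong (ιₙ (n C r) *_) (ιₙ-* (suc r) (r !)))
                        (solve 3 (λ c s f → c :* (s :* f) := s :* (c :* f))
                               refl (ιₙ (n C r)) (ιₙ (suc r)) (ιₙ (r !))))
                 (C*!≡↓ n (suc r)) ⟩
  ιₙ (suc r) * (ιₙ (n C r) * ιₙ (r !)) + ιₙ n ↓ suc r
    ≡⟨ cong (λ t → ιₙ (suc r) * t + ιₙ n ↓ suc r) (C*!≡↓ n r) ⟩
  ιₙ (suc r) * ιₙ n ↓ r + ιₙ n ↓ r * (ιₙ n - ιₙ r)
    ≡⟨ cong (λ s → s * ιₙ n ↓ r + ιₙ n ↓ r * (ιₙ n - ιₙ r)) (ιₙ-suc r) ⟩
  (1ℚ + ιₙ r) * ιₙ n ↓ r + ιₙ n ↓ r * (ιₙ n - ιₙ r)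
    ≡⟨ solve 3 (λ r f n → (con 1ℚ :+ r) :* f :+ f :* (n :- r) := (con 1ℚ :+ n) :* f)
         refl (ιₙ r) (ιₙ n ↓ r) (ιₙ n) ⟩
  (1ℚ + ιₙ n) * ιₙ n ↓ r
    ≡⟨ cong₂ (λ a b → a * b ↓ r) (sym (ιₙ-suc n)) (sym (ιₙ-pred n)) ⟩
  ιₙ (suc n) * (ιₙ (suc n) - 1ℚ) ↓ r
    ≡⟨ sym (↓-suc (ιₙ (suc n)) r) ⟩
  ιₙ (suc n) ↓ suc r ∎

↓-vanishes : ∀ {n r} → n < r → ιₙ n ↓ r ≡ 0ℚ
↓-vanishes {n} {r} n<r = begin
  ιₙ n ↓ r                ≡⟨ sym (C*!≡↓ n r) ⟩
  ιₙ (n C r) * ιₙ (r !)   ≡⟨ cong (λ c → ιₙ c * ιₙ (r !)) (k>n⇒nCk≡0 n<r) ⟩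
  0ℚ * ιₙ (r !)           ≡⟨ ℚP.*-zeroˡ (ιₙ (r !)) ⟩
  0ℚ                      ∎

↓*! : ∀ d m → ιₙ (d ℕ.+ m) ↓ d * ιₙ (m !) ≡ ιₙ ((d ℕ.+ m) !)
↓*! zero    m = ℚP.*-identityˡ (ιₙ (m !))
↓*! (suc d) m = begin
  ιₙ (suc d ℕ.+ m) ↓ suc d * ιₙ (m !)
    ≡⟨ cong (_* ιₙ (m !)) (trans (↓-suc _ d) (cong (λ x → ιₙ (suc d ℕ.+ m) * x ↓ d) (ιₙ-pred (d ℕ.+ m)))) ⟩
  ιₙ (suc d ℕ.+ m) * ιₙ (d ℕ.+ m) ↓ d * ιₙ (m !)
    ≡⟨ ℚP.*-assoc (ιₙ (suc d ℕ.+ m)) (ιₙ (d ℕ.+ m) ↓ d) (ιₙ (m !)) ⟩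
  ιₙ (suc d ℕ.+ m) * (ιₙ (d ℕ.+ m) ↓ d * ιₙ (m !))
    ≡⟨ cong (ιₙ (suc d ℕ.+ m) *_) (↓*! d m) ⟩
  ιₙ (suc d ℕ.+ m) * ιₙ ((d ℕ.+ m) !)
    ≡⟨ sym (ιₙ-* (suc d ℕ.+ m) ((d ℕ.+ m) !)) ⟩
  ιₙ ((suc d ℕ.+ m) !) ∎

neg-↓ : ∀ x l → (- x) ↓ l ≡ ι (-1ℤ ^ l) * (x + ιₙ l - 1ℚ) ↓ l
neg-↓ x zero    = refl
neg-↓ x (suc l) = begin
  (- x) ↓ l * (- x - ιₙ l)
    ≡⟨ cong (_* (- x - ιₙ l)) (neg-↓ x l) ⟩
  ι (-1ℤ ^ l) * (x + ιₙ l - 1ℚ) ↓ l * (- x - ιₙ l)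
    ≡⟨ solve 4 (λ s f x n → s :* f :* (:- x :- n) := (:- s) :* ((x :+ n) :* f))
         refl (ι (-1ℤ ^ l)) ((x + ιₙ l - 1ℚ) ↓ l) x (ιₙ l) ⟩
  - ι (-1ℤ ^ l) * ((x + ιₙ l) * (x + ιₙ l - 1ℚ) ↓ l)
    ≡⟨ cong₂ _*_ (ι-[-1]^suc l) (cong₂ (λ a b → a * b ↓ l) x+ιₙ[1+l]-1≡ (cong (_- 1ℚ) x+ιₙ[1+l]-1≡)) ⟨
  ι (-1ℤ ^ suc l) * ((x + ιₙ (suc l) - 1ℚ) * (x + ιₙ (suc l) - 1ℚ - 1ℚ) ↓ l)
    ≡⟨ cong (ι (-1ℤ ^ suc l) *_) (sym (↓-suc (x + ιₙ (suc l) - 1ℚ) l)) ⟩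
  ι (-1ℤ ^ suc l) * (x + ιₙ (suc l) - 1ℚ) ↓ suc l ∎
  where
  x+ιₙ[1+l]-1≡ : x + ιₙ (suc l) - 1ℚ ≡ x + ιₙ l
  x+ιₙ[1+l]-1≡ = trans (cong (λ n → x + n - 1ℚ) (ιₙ-suc l))
                       (solve 2 (λ x n → x :+ (con 1ℚ :+ n) :- con 1ℚ := x :+ n) refl x (ιₙ l))

vandermondeTerm : ℚ → ℚ → ℕ → ℕ → ℚ
vandermondeTerm x y n l = ιₙ (n C l) * x ↓ l * y ↓ (n ∸ l)

vandermonde : ∀ x y n → (x + y) ↓ n ≡ ∑[ l < suc n ] vandermondeTerm x y n (toℕ l)
vandermonde x y zero    = sym (ℚP.+-identityʳ (1ℚ * 1ℚ * 1ℚ))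
vandermonde x y (suc n) = begin
  (x + y) ↓ n * (x + y - ιₙ n)
    ≡⟨ cong (_* (x + y - ιₙ n)) (vandermonde x y n) ⟩
  (∑[ l < suc n ] T n (toℕ l)) * (x + y - ιₙ n)
    ≡⟨ *-distribʳ-sum {suc n} (x + y - ιₙ n) (λ l → T n (toℕ l)) ⟩
  ∑[ l < suc n ] (T n (toℕ l) * (x + y - ιₙ n))
    ≡⟨ sum-cong-≗ (λ l → split (toℕ l) (toℕ≤pred[n] l)) ⟩
  ∑[ l < suc n ] (A (toℕ l) + B (toℕ l))
    ≡⟨ ∑-distrib-+ {suc n} (λ l → A (toℕ l)) (λ l → B (toℕ l)) ⟩
    -- ∑ B unfolds to B 0 + ∑ (B ∘ suc), where B 0 = T (suc n) 0 and B (suc l) = A′ l.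
  ∑[ l < suc n ] A (toℕ l) + (T (suc n) 0 + ∑[ l < n ] A′ (toℕ l))
    ≡⟨ cong (λ s → ∑[ l < suc n ] A (toℕ l) + (T (suc n) 0 + s)) ∑A′-extend ⟩
  ∑[ l < suc n ] A (toℕ l) + (T (suc n) 0 + ∑[ l < suc n ] A′ (toℕ l))
    ≡⟨ solve 3 (λ a t b → a :+ (t :+ b) := t :+ (a :+ b))
         refl (∑[ l < suc n ] A (toℕ l)) (T (suc n) 0) (∑[ l < suc n ] A′ (toℕ l)) ⟩
  T (suc n) 0 + (∑[ l < suc n ] A (toℕ l) + ∑[ l < suc n ] A′ (toℕ l))
    ≡⟨ cong (T (suc n) 0 +_) (sym (∑-distrib-+ {suc n} (λ l → A (toℕ l)) (λ l → A′ (toℕ l)))) ⟩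
  T (suc n) 0 + ∑[ l < suc n ] (A (toℕ l) + A′ (toℕ l))
    ≡⟨ cong (T (suc n) 0 +_) (sum-cong-≗ {suc n} (λ l → sym (pascal (toℕ l)))) ⟩
  ∑[ l < suc (suc n) ] T (suc n) (toℕ l) ∎
  where
  T : ℕ → ℕ → ℚ
  T = vandermondeTerm x y
  A A′ B : ℕ → ℚ
  A  l = ιₙ (n C l) * x ↓ suc l * y ↓ (n ∸ l)
  A′ l = ιₙ (n C suc l) * x ↓ suc l * y ↓ (n ∸ l)
  B  l = ιₙ (n C l) * x ↓ l * y ↓ (suc n ∸ l)

  split : ∀ l → l ≤ n → T n l * (x + y - ιₙ n) ≡ A l + B l
  split l l≤n = begin
    ιₙ (n C l) * x ↓ l * y ↓ (n ∸ l) * (x + y - ιₙ n)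
      ≡⟨ solve 7 (λ c f g x y m l → c :* f :* g :* (x :+ y :- m)
                   := c :* (f :* (x :- l)) :* g :+ c :* f :* (g :* (y :- (m :- l))))
           refl (ιₙ (n C l)) (x ↓ l) (y ↓ (n ∸ l)) x y (ιₙ n) (ιₙ l) ⟩
    A l + ιₙ (n C l) * x ↓ l * (y ↓ (n ∸ l) * (y - (ιₙ n - ιₙ l)))
      ≡⟨ cong (λ z → A l + ιₙ (n C l) * x ↓ l * (y ↓ (n ∸ l) * (y - z))) (sym (ιₙ-∸ l≤n)) ⟩
    A l + ιₙ (n C l) * x ↓ l * y ↓ suc (n ∸ l)
      ≡⟨ cong (λ k → A l + ιₙ (n C l) * x ↓ l * y ↓ k) (sym (ℕP.+-∸-assoc 1 l≤n)) ⟩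
    A l + B l ∎

  pascal : ∀ l → T (suc n) (suc l) ≡ A l + A′ l
  pascal l = begin
    ιₙ (suc n C suc l) * x ↓ suc l * y ↓ (n ∸ l)
      ≡⟨ cong (λ c → ιₙ c * x ↓ suc l * y ↓ (n ∸ l)) (sym (nCk+nC[k+1]≡[n+1]C[k+1] n l)) ⟩
    ιₙ (n C l ℕ.+ n C suc l) * x ↓ suc l * y ↓ (n ∸ l)
      ≡⟨ cong (λ c → c * x ↓ suc l * y ↓ (n ∸ l)) (ιₙ-+ (n C l) (n C suc l)) ⟩
    (ιₙ (n C l) + ιₙ (n C suc l)) * x ↓ suc l * y ↓ (n ∸ l)
      ≡⟨ solve 4 (λ a b f g → (a :+ b) :* f :* g := a :* f :* g :+ b :* f :* g)
           refl (ιₙ (n C l)) (ιₙ (n C suc l)) (x ↓ suc l) (y ↓ (n ∸ l)) ⟩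
    A l + A′ l ∎

  ∑A′-extend : ∑[ l < n ] A′ (toℕ l) ≡ ∑[ l < suc n ] A′ (toℕ l)
  ∑A′-extend = sym (trans (cong (λ m → ∑[ l < m ] A′ (toℕ l)) (ℕP.+-comm 1 n))
                          (∑-truncate n 1 A′ A′-vanishes))
    where
    A′-vanishes : ∀ l → n ≤ l → A′ l ≡ 0ℚ
    A′-vanishes l n≤l = begin
      ιₙ (n C suc l) * x ↓ suc l * y ↓ (n ∸ l)
        ≡⟨ cong (λ c → ιₙ c * x ↓ suc l * y ↓ (n ∸ l)) (k>n⇒nCk≡0 (ℕ.s≤s n≤l)) ⟩
      0ℚ * x ↓ suc l * y ↓ (n ∸ l)
        ≡⟨ solve 2 (λ f g → con 0ℚ :* f :* g := con 0ℚ) refl (x ↓ suc l) (y ↓ (n ∸ l)) ⟩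
      0ℚ ∎

-- The triangular factor of the reciprocal Pascal matrix

-- For k = l = 0 the truncated k + l ∸ 1 is 0 rather than -1, which still gives w 0 0 = 1.
w : ℕ → ℕ → ℤ
w k l = -1ℤ ^ l ℤ.* ℤ.+ ((k C l) ℕ.* ((k ℕ.+ l ∸ 1) C l))

w-vanishes : ∀ {k l} → k < l → ι (w k l) ≡ 0ℚ
w-vanishes {k} {l} k<l =
  trans (cong (λ c → ι (-1ℤ ^ l ℤ.* ℤ.+ (c ℕ.* ((k ℕ.+ l ∸ 1) C l)))) (k>n⇒nCk≡0 k<l))
        (cong ι (ℤP.*-zeroʳ (-1ℤ ^ l)))

ι-w*! : ∀ k l → ι (w k l) * ιₙ (l !) ≡ ιₙ (k C l) * (- ιₙ k) ↓ l
ι-w*! k l = begin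
  ι (w k l) * ιₙ (l !)
    ≡⟨ cong (_* ιₙ (l !)) (trans (ι-* (-1ℤ ^ l) (ℤ.+ (c ℕ.* d))) (cong (s *_) (ιₙ-* c d))) ⟩
  s * (ιₙ c * ιₙ d) * ιₙ (l !)
    ≡⟨ solve 4 (λ s c d f → s :* (c :* d) :* f := c :* (s :* (d :* f))) refl s (ιₙ c) (ιₙ d) (ιₙ (l !)) ⟩
  ιₙ c * (s * (ιₙ d * ιₙ (l !)))
    ≡⟨ cong (λ t → ιₙ c * (s * t)) (trans (C*!≡↓ (k ℕ.+ l ∸ 1) l) (ιₙ[k+l-1]↓l l)) ⟩
  ιₙ c * (s * (ιₙ k + ιₙ l - 1ℚ) ↓ l)
    ≡⟨ cong (ιₙ c *_) (sym (neg-↓ (ιₙ k) l)) ⟩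
  ιₙ c * (- ιₙ k) ↓ l ∎
  where
  s : ℚ
  s = ι (-1ℤ ^ l)

  c d : ℕ
  c = k C l
  d = (k ℕ.+ l ∸ 1) C l

  ιₙ[k+l-1]↓l : ∀ l → ιₙ (k ℕ.+ l ∸ 1) ↓ l ≡ (ιₙ k + ιₙ l - 1ℚ) ↓ l
  ιₙ[k+l-1]↓l zero    = refl
  ιₙ[k+l-1]↓l (suc l) = cong (_↓ suc l) (begin
    ιₙ (k ℕ.+ suc l ∸ 1)      ≡⟨ cong (λ m → ιₙ (m ∸ 1)) (ℕP.+-suc k l) ⟩
    ιₙ (k ℕ.+ l)              ≡⟨ ιₙ-+ k l ⟩
    ιₙ k + ιₙ l               ≡⟨ solve 2 (λ k l → k :+ l := k :+ (con 1ℚ :+ l) :- con 1ℚ) refl (ιₙ k) (ιₙ l) ⟩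
    ιₙ k + (1ℚ + ιₙ l) - 1ℚ   ≡⟨ cong (λ m → ιₙ k + m - 1ℚ) (sym (ιₙ-suc l)) ⟩
    ιₙ k + ιₙ (suc l) - 1ℚ    ∎)

1/_! : ℕ → ℚ
1/ n ! = 1/ₙ (n !) {{n ℕP.!≢0}}

f : ℕ → ℕ → ℚ
f a k = ιₙ (a !) * ιₙ a ↓ k * 1/ (a ℕ.+ k) !

f-vanishes : ∀ {a k} → a < k → f a k ≡ 0ℚ
f-vanishes {a} {k} a<k = begin
  ιₙ (a !) * ιₙ a ↓ k * 1/ (a ℕ.+ k) !  ≡⟨ cong (λ t → ιₙ (a !) * t * 1/ (a ℕ.+ k) !) (↓-vanishes a<k) ⟩
  ιₙ (a !) * 0ℚ * 1/ (a ℕ.+ k) !        ≡⟨ solve 2 (λ x y → x :* con 0ℚ :* y := con 0ℚ) refl (ιₙ (a !)) (1/ (a ℕ.+ k) !) ⟩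
  0ℚ                                       ∎

recipBinom-sym : ∀ a l → recipBinom a l ≡ recipBinom l a
recipBinom-sym a l = 1/ₙ-cong
  {{ℕ.>-nonZero (C-pos (a ℕ.+ l) a (ℕP.m≤m+n a l))}} {{ℕ.>-nonZero (C-pos (l ℕ.+ a) l (ℕP.m≤m+n l a))}}
  (begin
    (a ℕ.+ l) C a              ≡⟨ nCk≡nC[n∸k] (ℕP.m≤m+n a l) ⟩
    (a ℕ.+ l) C (a ℕ.+ l ∸ a)  ≡⟨ cong ((a ℕ.+ l) C_) (ℕP.m+n∸m≡n a l) ⟩
    (a ℕ.+ l) C l              ≡⟨ cong (_C l) (ℕP.+-comm a l) ⟩
    (l ℕ.+ a) C l              ∎)
  where
  1/ₙ-cong : ∀ {m m′} .{{_ : NonZero m}} .{{_ : NonZero m′}} → m ≡ m′ → 1/ₙ m ≡ 1/ₙ m′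
  1/ₙ-cong refl = refl

recipBinom*C : ∀ a l → recipBinom a l * ιₙ ((a ℕ.+ l) C a) ≡ 1ℚ
recipBinom*C a l = 1/ₙ*ιₙ ((a ℕ.+ l) C a) {{ℕ.>-nonZero (C-pos (a ℕ.+ l) a (ℕP.m≤m+n a l))}}

[a+l]!≡C*a!*l! : ∀ a l → ιₙ ((a ℕ.+ l) !) ≡ ιₙ ((a ℕ.+ l) C a) * ιₙ (a !) * ιₙ (l !)
[a+l]!≡C*a!*l! a l = begin
  ιₙ ((a ℕ.+ l) !)                             ≡⟨ sym (↓*! a l) ⟩
  ιₙ (a ℕ.+ l) ↓ a * ιₙ (l !)                  ≡⟨ cong (_* ιₙ (l !)) (sym (C*!≡↓ (a ℕ.+ l) a)) ⟩
  ιₙ ((a ℕ.+ l) C a) * ιₙ (a !) * ιₙ (l !)     ∎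

[a+k]!≡[a+l]!*↓ : ∀ a {k l} → l ≤ k → ιₙ ((a ℕ.+ k) !) ≡ ιₙ ((a ℕ.+ l) !) * ιₙ (a ℕ.+ k) ↓ (k ∸ l)
[a+k]!≡[a+l]!*↓ a {k} {l} l≤k = begin
  ιₙ ((a ℕ.+ k) !)                                   ≡⟨ cong (λ m → ιₙ (m !)) a+k≡ ⟩
  ιₙ ((k ∸ l ℕ.+ (a ℕ.+ l)) !)                       ≡⟨ sym (↓*! (k ∸ l) (a ℕ.+ l)) ⟩
  ιₙ (k ∸ l ℕ.+ (a ℕ.+ l)) ↓ (k ∸ l) * ιₙ ((a ℕ.+ l) !)
                                                     ≡⟨ cong (λ m → ιₙ m ↓ (k ∸ l) * ιₙ ((a ℕ.+ l) !)) (sym a+k≡) ⟩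
  ιₙ (a ℕ.+ k) ↓ (k ∸ l) * ιₙ ((a ℕ.+ l) !)          ≡⟨ ℚP.*-comm (ιₙ (a ℕ.+ k) ↓ (k ∸ l)) (ιₙ ((a ℕ.+ l) !)) ⟩
  ιₙ ((a ℕ.+ l) !) * ιₙ (a ℕ.+ k) ↓ (k ∸ l)          ∎
  where
  a+k≡ : a ℕ.+ k ≡ k ∸ l ℕ.+ (a ℕ.+ l)
  a+k≡ = begin
    a ℕ.+ k                 ≡⟨ cong (a ℕ.+_) (sym (ℕP.m+[n∸m]≡n l≤k)) ⟩
    a ℕ.+ (l ℕ.+ (k ∸ l))   ≡⟨ sym (ℕP.+-assoc a l (k ∸ l)) ⟩
    a ℕ.+ l ℕ.+ (k ∸ l)     ≡⟨ ℕP.+-comm (a ℕ.+ l) (k ∸ l) ⟩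
    k ∸ l ℕ.+ (a ℕ.+ l)     ∎

recipBinom*w*! : ∀ a k l → recipBinom a l * ι (w k l) * ιₙ ((a ℕ.+ k) !)
                         ≡ ιₙ (a !) * vandermondeTerm (- ιₙ k) (ιₙ (a ℕ.+ k)) k l
recipBinom*w*! a k l with l ℕ.≤? k
... | yes l≤k = begin
  r * ι (w k l) * ιₙ ((a ℕ.+ k) !)
    ≡⟨ cong (r * ι (w k l) *_) (trans ([a+k]!≡[a+l]!*↓ a l≤k) (cong (_* Y) ([a+l]!≡C*a!*l! a l))) ⟩
  r * ι (w k l) * (ιₙ ((a ℕ.+ l) C a) * ιₙ (a !) * ιₙ (l !) * Y)
    ≡⟨ solve 6 (λ r v c a l y → r :* v :* (c :* a :* l :* y) := (r :* c) :* (a :* (v :* l :* y)))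
         refl r (ι (w k l)) (ιₙ ((a ℕ.+ l) C a)) (ιₙ (a !)) (ιₙ (l !)) Y ⟩
  (r * ιₙ ((a ℕ.+ l) C a)) * (ιₙ (a !) * (ι (w k l) * ιₙ (l !) * Y))
    ≡⟨ cong₂ (λ u v → u * (ιₙ (a !) * (v * Y))) (recipBinom*C a l) (ι-w*! k l) ⟩
  1ℚ * (ιₙ (a !) * (ιₙ (k C l) * (- ιₙ k) ↓ l * Y))
    ≡⟨ ℚP.*-identityˡ _ ⟩
  ιₙ (a !) * vandermondeTerm (- ιₙ k) (ιₙ (a ℕ.+ k)) k l ∎
  where
  r Y : ℚ
  r = recipBinom a l
  Y = ιₙ (a ℕ.+ k) ↓ (k ∸ l)
... | no l≰k = begin
  recipBinom a l * ι (w k l) * ιₙ ((a ℕ.+ k) !)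
    ≡⟨ cong (λ v → recipBinom a l * v * ιₙ ((a ℕ.+ k) !)) (w-vanishes k<l) ⟩
  recipBinom a l * 0ℚ * ιₙ ((a ℕ.+ k) !)
    ≡⟨ solve 5 (λ r p a x y → r :* con 0ℚ :* p := a :* (con 0ℚ :* x :* y))
         refl (recipBinom a l) (ιₙ ((a ℕ.+ k) !)) (ιₙ (a !)) ((- ιₙ k) ↓ l) (ιₙ (a ℕ.+ k) ↓ (k ∸ l)) ⟩
  ιₙ (a !) * (0ℚ * (- ιₙ k) ↓ l * ιₙ (a ℕ.+ k) ↓ (k ∸ l))
    ≡⟨ cong (λ c → ιₙ (a !) * (ιₙ c * (- ιₙ k) ↓ l * ιₙ (a ℕ.+ k) ↓ (k ∸ l))) (sym (k>n⇒nCk≡0 k<l)) ⟩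
  ιₙ (a !) * vandermondeTerm (- ιₙ k) (ιₙ (a ℕ.+ k)) k l ∎
  where
  k<l : k < l
  k<l = ℕP.≰⇒> l≰k

∑recipBinom*w≡f : ∀ {N} a k → k < N → ∑[ l < N ] (recipBinom a (toℕ l) * ι (w k (toℕ l))) ≡ f a k
∑recipBinom*w≡f {N} a k k<N = begin
  s                                 ≡⟨ sym (ℚP.*-identityʳ s) ⟩
  s * 1ℚ                            ≡⟨ cong (s *_) (sym (1/ₙ*ιₙ ((a ℕ.+ k) !) {{(a ℕ.+ k) ℕP.!≢0}})) ⟩
  s * (1/ (a ℕ.+ k) ! * P)          ≡⟨ solve 3 (λ s q p → s :* (q :* p) := s :* p :* q) refl s (1/ (a ℕ.+ k) !) P ⟩
  s * P * 1/ (a ℕ.+ k) !            ≡⟨ cong (_* 1/ (a ℕ.+ k) !) s*P≡ ⟩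
  ιₙ (a !) * ιₙ a ↓ k * 1/ (a ℕ.+ k) ! ∎
  where
  s P : ℚ
  s = ∑[ l < N ] (recipBinom a (toℕ l) * ι (w k (toℕ l)))
  P = ιₙ ((a ℕ.+ k) !)

  V : ℕ → ℚ
  V = vandermondeTerm (- ιₙ k) (ιₙ (a ℕ.+ k)) k

  V-vanishes : ∀ l → suc k ≤ l → V l ≡ 0ℚ
  V-vanishes l k<l = begin
    ιₙ (k C l) * (- ιₙ k) ↓ l * ιₙ (a ℕ.+ k) ↓ (k ∸ l)
      ≡⟨ cong (λ c → ιₙ c * (- ιₙ k) ↓ l * ιₙ (a ℕ.+ k) ↓ (k ∸ l)) (k>n⇒nCk≡0 k<l) ⟩
    0ℚ * (- ιₙ k) ↓ l * ιₙ (a ℕ.+ k) ↓ (k ∸ l)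
      ≡⟨ solve 2 (λ x y → con 0ℚ :* x :* y := con 0ℚ) refl ((- ιₙ k) ↓ l) (ιₙ (a ℕ.+ k) ↓ (k ∸ l)) ⟩
    0ℚ ∎

  ∑V≡ : ∑[ l < N ] V (toℕ l) ≡ ιₙ a ↓ k
  ∑V≡ = begin
    ∑[ l < N ] V (toℕ l)                     ≡⟨ cong (λ M → ∑[ l < M ] V (toℕ l)) (sym (ℕP.m+[n∸m]≡n k<N)) ⟩
    ∑[ l < suc k ℕ.+ (N ∸ suc k) ] V (toℕ l) ≡⟨ ∑-truncate (suc k) (N ∸ suc k) V V-vanishes ⟩
    ∑[ l < suc k ] V (toℕ l)                 ≡⟨ sym (vandermonde (- ιₙ k) (ιₙ (a ℕ.+ k)) k) ⟩
    (- ιₙ k + ιₙ (a ℕ.+ k)) ↓ k              ≡⟨ cong (λ t → (- ιₙ k + t) ↓ k) (ιₙ-+ a k) ⟩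
    (- ιₙ k + (ιₙ a + ιₙ k)) ↓ k             ≡⟨ cong (_↓ k) (solve 2 (λ a k → :- k :+ (a :+ k) := a) refl (ιₙ a) (ιₙ k)) ⟩
    ιₙ a ↓ k                                 ∎

  s*P≡ : s * P ≡ ιₙ (a !) * ιₙ a ↓ k
  s*P≡ = begin
    s * P                                            ≡⟨ *-distribʳ-sum {N} P (λ l → recipBinom a (toℕ l) * ι (w k (toℕ l))) ⟩
    ∑[ l < N ] (recipBinom a (toℕ l) * ι (w k (toℕ l)) * P) ≡⟨ sum-cong-≗ {N} (λ l → recipBinom*w*! a k (toℕ l)) ⟩
    ∑[ l < N ] (ιₙ (a !) * V (toℕ l))                ≡⟨ sym (*-distribˡ-sum {N} (ιₙ (a !)) (λ l → V (toℕ l))) ⟩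
    ιₙ (a !) * ∑[ l < N ] V (toℕ l)                  ≡⟨ cong (ιₙ (a !) *_) ∑V≡ ⟩
    ιₙ (a !) * ιₙ a ↓ k                              ∎

-- 1 / ε k is the diagonal entry w k k · f k k = (-1)^k C(2k-1,k) / C(2k,k) of W R Wᵀ.
ε : ℕ → ℤ
ε zero    = ℤ.+ 1
ε (suc k) = -1ℤ ^ suc k ℤ.* ℤ.+ 2

ι[-1]^l*ι[-1]^l : ∀ l → ι (-1ℤ ^ l) * ι (-1ℤ ^ l) ≡ 1ℚ
ι[-1]^l*ι[-1]^l zero    = refl
ι[-1]^l*ι[-1]^l (suc l) = begin
  ι (-1ℤ ^ suc l) * ι (-1ℤ ^ suc l)  ≡⟨ cong₂ _*_ (ι-[-1]^suc l) (ι-[-1]^suc l) ⟩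
  - ι (-1ℤ ^ l) * - ι (-1ℤ ^ l)      ≡⟨ solve 1 (λ s → :- s :* :- s := s :* s) refl (ι (-1ℤ ^ l)) ⟩
  ι (-1ℤ ^ l) * ι (-1ℤ ^ l)          ≡⟨ ι[-1]^l*ι[-1]^l l ⟩
  1ℚ                                 ∎

w*f*ε≡1 : ∀ k → ι (w k k) * f k k * ι (ε k) ≡ 1ℚ
w*f*ε≡1 zero      = refl
w*f*ε≡1 k@(suc m) = begin
  ι (w k k) * (ιₙ (k !) * ιₙ k ↓ k * 1/ (k ℕ.+ k) !) * ι (ε k)
    ≡⟨ cong₂ (λ u v → u * (ιₙ (k !) * v * 1/ (k ℕ.+ k) !) * ι (ε k)) ι[w[k,k]] ιₙk↓k ⟩
  s * ιₙ (n C k) * (ιₙ (k !) * ιₙ (k !) * 1/ (k ℕ.+ k) !) * ι (ε k)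
    ≡⟨ cong (s * ιₙ (n C k) * (ιₙ (k !) * ιₙ (k !) * 1/ (k ℕ.+ k) !) *_) (ι-* (-1ℤ ^ k) (ℤ.+ 2)) ⟩
  s * ιₙ (n C k) * (ιₙ (k !) * ιₙ (k !) * 1/ (k ℕ.+ k) !) * (s * ιₙ 2)
    ≡⟨ solve 6 (λ s c f g r t → s :* c :* (f :* g :* r) :* (s :* t) := (s :* s) :* ((c :* f :* g :* t) :* r))
         refl s (ιₙ (n C k)) (ιₙ (k !)) (ιₙ (k !)) (1/ (k ℕ.+ k) !) (ιₙ 2) ⟩
  (s * s) * ((ιₙ (n C k) * ιₙ (k !) * ιₙ (k !) * ιₙ 2) * 1/ (k ℕ.+ k) !)
    ≡⟨ cong₂ (λ u v → u * (v * 1/ (k ℕ.+ k) !)) (ι[-1]^l*ι[-1]^l k) C*k!*k!*2≡[k+k]! ⟩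
  1ℚ * (ιₙ ((k ℕ.+ k) !) * 1/ (k ℕ.+ k) !)
    ≡⟨ trans (ℚP.*-identityˡ _) (trans (ℚP.*-comm (ιₙ ((k ℕ.+ k) !)) (1/ (k ℕ.+ k) !))
                                     (1/ₙ*ιₙ ((k ℕ.+ k) !) {{(k ℕ.+ k) ℕP.!≢0}})) ⟩
  1ℚ ∎
  where
  s : ℚ
  s = ι (-1ℤ ^ k)

  n : ℕ
  n = m ℕ.+ k

  ι[w[k,k]] : ι (w k k) ≡ s * ιₙ (n C k)
  ι[w[k,k]] = begin
    ι (w k k)                         ≡⟨ ι-* (-1ℤ ^ k) (ℤ.+ ((k C k) ℕ.* (n C k))) ⟩
    s * ιₙ ((k C k) ℕ.* (n C k))      ≡⟨ cong (λ c → s * ιₙ (c ℕ.* (n C k))) (nCn≡1 k) ⟩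
    s * ιₙ (1 ℕ.* (n C k))            ≡⟨ cong (λ c → s * ιₙ c) (ℕP.*-identityˡ (n C k)) ⟩
    s * ιₙ (n C k)                    ∎

  ιₙk↓k : ιₙ k ↓ k ≡ ιₙ (k !)
  ιₙk↓k = begin
    ιₙ k ↓ k                  ≡⟨ sym (C*!≡↓ k k) ⟩
    ιₙ (k C k) * ιₙ (k !)     ≡⟨ cong (λ c → ιₙ c * ιₙ (k !)) (nCn≡1 k) ⟩
    1ℚ * ιₙ (k !)             ≡⟨ ℚP.*-identityˡ (ιₙ (k !)) ⟩
    ιₙ (k !)                  ∎

  C*k!*k!*2≡[k+k]! : ιₙ (n C k) * ιₙ (k !) * ιₙ (k !) * ιₙ 2 ≡ ιₙ ((k ℕ.+ k) !)
  C*k!*k!*2≡[k+k]! = begin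
    ιₙ (n C k) * ιₙ (k !) * ιₙ (k !) * ιₙ 2
      ≡⟨ cong₂ (λ u v → u * v * ιₙ 2) (C*!≡↓ n k) (ιₙ-* k (m !)) ⟩
    ιₙ n ↓ k * (ιₙ k * ιₙ (m !)) * ιₙ 2
      ≡⟨ solve 4 (λ d k f t → d :* (k :* f) :* t := (d :* f) :* (t :* k)) refl (ιₙ n ↓ k) (ιₙ k) (ιₙ (m !)) (ιₙ 2) ⟩
    ιₙ n ↓ k * ιₙ (m !) * (ιₙ 2 * ιₙ k)
      ≡⟨ cong₂ _*_ n↓k*m!≡n! (trans (sym (ιₙ-* 2 k)) (cong ιₙ (cong (k ℕ.+_) (ℕP.+-identityʳ k)))) ⟩
    ιₙ (n !) * ιₙ (k ℕ.+ k)
      ≡⟨ trans (ℚP.*-comm (ιₙ (n !)) (ιₙ (k ℕ.+ k))) (sym (ιₙ-* (k ℕ.+ k) (n !))) ⟩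
    ιₙ ((k ℕ.+ k) !) ∎
    where
    n↓k*m!≡n! : ιₙ n ↓ k * ιₙ (m !) ≡ ιₙ (n !)
    n↓k*m!≡n! = subst (λ j → ιₙ j ↓ k * ιₙ (m !) ≡ ιₙ (j !)) (sym (ℕP.+-suc m m)) (↓*! k m)

module _ (n : ℕ) where

  W : Matrix ℚ n
  W i j = ι (w (toℕ i) (toℕ j))

  E : Fin n → ℚ
  E k = ι (ε (toℕ k))

  S : Matrix ℤ n
  S i j = ℤΣ.sum {n} (λ k → w (toℕ k) (toℕ i) ℤ.* (ε (toℕ k) ℤ.* w (toℕ k) (toℕ j)))

  D : Matrix ℚ n
  D = W · (R n · W ᵀ)

  W-lowerTriangular : LowerTriangular W
  W-lowerTriangular = w-vanishes

  R·Wᵀ≡f : ∀ a k → (R n · W ᵀ) a k ≡ f (toℕ a) (toℕ k)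
  R·Wᵀ≡f a k = trans (·-sum (R n) (W ᵀ) a k) (∑recipBinom*w≡f (toℕ a) (toℕ k) (toℕ<n k))

  R·Wᵀ-lowerTriangular : LowerTriangular (R n · W ᵀ)
  R·Wᵀ-lowerTriangular {a} {k} a<k = trans (R·Wᵀ≡f a k) (f-vanishes a<k)

  R-symmetric : R n ᵀ ≋ R n
  R-symmetric a l = recipBinom-sym (toℕ l) (toℕ a)

  D-lowerTriangular : LowerTriangular D
  D-lowerTriangular = ·-lowerTriangular W-lowerTriangular R·Wᵀ-lowerTriangular

  D-offDiagonal : ∀ {i j} → i ≢ j → D i j ≡ 0ℚ
  D-offDiagonal {i} {j} i≢j with <-cmp i j
  ... | tri< i<j _ _ = D-lowerTriangular i<j
  ... | tri≈ _ i≡j _ = contradiction i≡j i≢j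
  ... | tri> _ _ j<i = trans (sym (congruence-symmetric (R n) W R-symmetric i j)) (D-lowerTriangular j<i)

  D*E≡1 : ∀ i → D i i * E i ≡ 1ℚ
  D*E≡1 i = begin
    D i i * E i
      ≡⟨ cong (_* E i) (·-lowerTriangular-diagonal W-lowerTriangular R·Wᵀ-lowerTriangular i) ⟩
    W i i * (R n · W ᵀ) i i * E i    ≡⟨ cong (λ x → W i i * x * E i) (R·Wᵀ≡f i i) ⟩
    W i i * f (toℕ i) (toℕ i) * E i  ≡⟨ w*f*ε≡1 (toℕ i) ⟩
    1ℚ                               ∎

  D·E≋I : D · diag E ≋ I
  D·E≋I i j with i ≟ j
  ... | yes refl = trans (·-diag D E i i) (trans (D*E≡1 i) (sym (I-diagonal i)))
  ... | no  i≢j  = begin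
    (D · diag E) i j  ≡⟨ ·-diag D E i j ⟩
    D i j * E j       ≡⟨ cong (_* E j) (D-offDiagonal i≢j) ⟩
    0ℚ * E j          ≡⟨ ℚP.*-zeroˡ (E j) ⟩
    0ℚ                ≡⟨ sym (I-offDiagonal i≢j) ⟩
    I i j             ∎

  W-regular : ∀ i → W i i ≢ 0ℚ
  W-regular i Wii≡0 = ℚP.1≢0 (begin
    1ℚ                                ≡⟨ sym (w*f*ε≡1 (toℕ i)) ⟩
    W i i * f (toℕ i) (toℕ i) * E i   ≡⟨ cong (λ x → x * f (toℕ i) (toℕ i) * E i) Wii≡0 ⟩
    0ℚ * f (toℕ i) (toℕ i) * E i      ≡⟨ solve 2 (λ x e → con 0ℚ :* x :* e := con 0ℚ) refl (f (toℕ i) (toℕ i)) (E i) ⟩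
    0ℚ                                ∎)

  S≋Wᵀ·E·W : toℚ S ≋ W ᵀ · (diag E · W)
  S≋Wᵀ·E·W i j = begin
    toℚ S i j                                 ≡⟨ ι-∑ {n} (λ k → w (toℕ k) (toℕ i) ℤ.* (ε (toℕ k) ℤ.* w (toℕ k) (toℕ j))) ⟩
    ∑[ k < n ] ι (w (toℕ k) (toℕ i) ℤ.* (ε (toℕ k) ℤ.* w (toℕ k) (toℕ j)))
                                              ≡⟨ sum-cong-≗ {n} ι-term ⟩
    ∑[ k < n ] (W k i * (E k * W k j))        ≡⟨ sum-cong-≗ (λ k → cong (W k i *_) (sym (diag-· E W k j))) ⟩
    ∑[ k < n ] (W k i * (diag E · W) k j)     ≡⟨ sym (·-sum (W ᵀ) (diag E · W) i j) ⟩
    (W ᵀ · (diag E · W)) i j                  ∎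
    where
    ι-term : ∀ k → ι (w (toℕ k) (toℕ i) ℤ.* (ε (toℕ k) ℤ.* w (toℕ k) (toℕ j))) ≡ W k i * (E k * W k j)
    ι-term k = trans (ι-* (w (toℕ k) (toℕ i)) (ε (toℕ k) ℤ.* w (toℕ k) (toℕ j)))
                     (cong (W k i *_) (ι-* (ε (toℕ k)) (w (toℕ k) (toℕ j))))

  S-symmetric : toℚ S ᵀ ≋ toℚ S
  S-symmetric i j =
    cong ι (ℤΣ.sum-cong-≗ {n} (λ k → x∙yz≈z∙yx (w (toℕ k) (toℕ j)) (ε (toℕ k)) (w (toℕ k) (toℕ i))))
    where open CommSemigroupProperties ℤP.*-commutativeSemigroup using (x∙yz≈z∙yx)

  W·R·S≋W : W · (R n · toℚ S) ≋ W
  W·R·S≋W i j = begin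
    (W · (R n · toℚ S)) i j                 ≡⟨ ·-congˡ W (·-congˡ (R n) S≋Wᵀ·E·W) i j ⟩
    (W · (R n · (W ᵀ · (diag E · W)))) i j  ≡⟨ ·-congˡ W (·-assoc (R n) (W ᵀ) (diag E · W)) i j ⟩
    (W · ((R n · W ᵀ) · (diag E · W))) i j  ≡⟨ ·-assoc W (R n · W ᵀ) (diag E · W) i j ⟩
    (D · (diag E · W)) i j                  ≡⟨ ·-assoc D (diag E) W i j ⟩
    ((D · diag E) · W) i j                  ≡⟨ ·-congʳ W D·E≋I i j ⟩
    (I · W) i j                             ≡⟨ ·-identityˡ W i j ⟩
    W i j                                   ∎

  R·S≋I : R n · toℚ S ≋ I
  R·S≋I = lowerTriangular-cancelˡ W-lowerTriangular W-regular
            (λ i j → trans (W·R·S≋W i j) (sym (·-identityʳ W i j)))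

  S·R≋I : toℚ S · R n ≋ I
  S·R≋I i j = begin
    (toℚ S · R n) i j      ≡⟨ ·-cong (λ a b → sym (S-symmetric a b)) (λ a b → sym (R-symmetric a b)) i j ⟩
    (toℚ S ᵀ · R n ᵀ) i j  ≡⟨ sym (·-ᵀ (R n) (toℚ S) i j) ⟩
    (R n · toℚ S) j i      ≡⟨ R·S≋I j i ⟩
    I j i                  ≡⟨ I-symmetric i j ⟩
    I i j                  ∎

mainTheorem4 : (n : ℕ) → 1 ≤ n →
    ∃[ S ] (((i j : _) → (R n · toℚ {n} S) i j ≡ I i j)
    × ((i j : _) → (toℚ {n} S · R n) i j ≡ I i j))
mainTheorem4 n _ = S n , R·S≋I n , S·R≋I n
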